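{- Let $G$ be a finite connected graph and $R$ a USP-relation on $E(G)$. Then for every $R$-class $\varphi$, the partition $\mathcal P^R_{\overline\varphi}=\{V(G^x_{\overline\varphi})\mid x\in V(G)\}$ of $V(G)$ is an equitable partition of the graph $G_\varphi$.
   Context: For $\varphi\subseteq E(G)$, $G_\varphi$ is the spanning subgraph with vertex set $V(G)$ and edge set $\varphi$, $G_\varphi^x$ its connected component containing $x$, and $\overline\varphi=E(G)\setminus\varphi$. A chordless square is an induced 4-cycle. An equivalence relation $Q$ on $E(G)$ has the unique square property if any two adjacent edges in distinct $Q$-classes are contained in exactly one chordless square whose opposite edges lie in the same $Q$-class. $R$ is a USP-relation if some equivalence relation $Q\subseteq R$ has the unique square property. A partition $\mathcal P$ of the vertex set of a graph $H$ is equitable if for all (not necessarily distinct) $A,B\in\mathcal P$ every $x\in A$ has the same number $|N_H(x)\cap B|$ of neighbours in $B$. -}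

module Defs where

open import Data.Nat using (ℕ)
open import Data.Fin using (Fin; _<_)
open import Data.Bool using (Bool; true; false)
open import Data.Product using (Σ; _×_; _,_; ∃; ∃!; proj₁)
open import Data.Sum using (_⊎_)
open import Data.Unit using (⊤)
open import Data.List using (List; length)
open import Data.List.Membership.Propositional using (_∈_)
open import Data.List.Relation.Unary.Unique.Propositional using (Unique)
open import Relation.Binary.PropositionalEquality using (_≡_)
open import Relation.Nullary using (¬_)
open import Function.Bundles using (_⇔_)

record Graph (n : ℕ) : Set where
  field
    adj    : Fin n → Fin n → Bool
    sym    : ∀ x y → adj x y ≡ adj y x
    irrefl : ∀ x → adj x x ≡ false
open Graph public

Adj : ∀ {n} → Graph n → Fin n → Fin n → Set
Adj G x y = adj G x y ≡ true

-- An edge {x,y} of G, stored with x < y.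
record Edge {n} (G : Graph n) : Set where
  constructor edge
  field
    src    : Fin n
    tgt    : Fin n
    src<tgt : src < tgt
    isAdj  : Adj G src tgt
open Edge public

EdgeOn : ∀ {n} {G : Graph n} → Edge G → Fin n → Fin n → Set
EdgeOn e x y = (src e ≡ x × tgt e ≡ y) ⊎ (src e ≡ y × tgt e ≡ x)

-- relations on E(G) (Bool-valued: E(G) is finite)
EdgeRel : ∀ {n} → Graph n → Set
EdgeRel G = Edge G → Edge G → Bool

Rel⟨_⟩ : ∀ {n} {G : Graph n} → EdgeRel G → Edge G → Edge G → Set
Rel⟨ R ⟩ e f = R e f ≡ true

record IsEquivRel {n} {G : Graph n} (R : EdgeRel G) : Set where
  field
    refl  : ∀ e → Rel⟨ R ⟩ e e
    sym   : ∀ e f → Rel⟨ R ⟩ e f → Rel⟨ R ⟩ f e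
    trans : ∀ e f g → Rel⟨ R ⟩ e f → Rel⟨ R ⟩ f g → Rel⟨ R ⟩ e g

EdgeSet : ∀ {n} → Graph n → Set₁
EdgeSet G = Edge G → Set

AdjIn : ∀ {n} {G : Graph n} → EdgeSet G → Fin n → Fin n → Set
AdjIn {G = G} φ x y = Σ (Edge G) λ e → EdgeOn e x y × φ e

-- y lies in the connected component G_φ^x (walks in G_φ)
data Reach {n} {G : Graph n} (φ : EdgeSet G) (x : Fin n) : Fin n → Set where
  here : Reach φ x x
  step : ∀ {y z} → Reach φ x y → AdjIn φ y z → Reach φ x z

Connected : ∀ {n} → Graph n → Set
Connected G = ∀ x y → Reach {G = G} (λ _ → ⊤) x y

ChordlessSquare : ∀ {n} → Graph n → Fin n → Fin n → Fin n → Fin n → Set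
ChordlessSquare G a b c d =
  ¬ a ≡ b × ¬ a ≡ c × ¬ a ≡ d × ¬ b ≡ c × ¬ b ≡ d × ¬ c ≡ d ×
  Adj G a b × Adj G b c × Adj G c d × Adj G d a ×
  ¬ Adj G a c × ¬ Adj G b d

RelToEdgeOn : ∀ {n} {G : Graph n} → EdgeRel G → Edge G → Fin n → Fin n → Set
RelToEdgeOn {G = G} Q e x y = Σ (Edge G) λ g → EdgeOn g x y × Rel⟨ Q ⟩ e g

-- Unique square property: for adjacent edges e = ab, f = bc (a ≠ c) in distinct
-- Q-classes there is exactly one chordless square a-b-c-d containing them
-- (a square containing both e and f is determined by its fourth vertex d)
-- whose opposite edges are Q-related: e Q cd and f Q da.
UniqueSquareProperty : ∀ {n} {G : Graph n} → EdgeRel G → Set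
UniqueSquareProperty {n} {G} Q =
  ∀ (e f : Edge G) (a b c : Fin n) → EdgeOn e a b → EdgeOn f b c → ¬ a ≡ c →
  ¬ Rel⟨ Q ⟩ e f →
  ∃! _≡_ λ (d : Fin n) →
    ChordlessSquare G a b c d × RelToEdgeOn Q e c d × RelToEdgeOn Q f d a

IsUSPRelation : ∀ {n} {G : Graph n} → EdgeRel G → Set
IsUSPRelation {G = G} R =
  Σ (EdgeRel G) λ Q → IsEquivRel Q × UniqueSquareProperty Q ×
    (∀ e f → Rel⟨ Q ⟩ e f → Rel⟨ R ⟩ e f)

HasSize : ∀ {n} → (Fin n → Set) → ℕ → Set
HasSize {n} P k = Σ (List (Fin n)) λ xs →
  Unique xs × length xs ≡ k × (∀ y → (y ∈ xs) ⇔ P y)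

-- the partition of V(H) into blocks  block z  (z ∈ V) is equitable for
-- the graph with adjacency A: vertices in the same block have the same
-- number of A-neighbours in every block
IsEquitable : ∀ {n} → (Fin n → Fin n → Set) → (Fin n → Fin n → Set) → Set
IsEquitable {n} block A =
  ∀ (x x' z : Fin n) → block x x' →
  ∃ λ k → HasSize (λ y → A x y × block z y) k × HasSize (λ y → A x' y × block z y) k

-- Let Q be an equivalence relation on E(G) with the unique square property
-- and let φ be a union of Q-classes.  If x x' is an edge outside φ and w is
-- a φ-neighbour of x, the unique chordless square w-x-x'-d through the edges
-- xw and xx' has its fourth vertex d as a φ-neighbour of x' (since x'd Q xw)
-- and the closing edge dw lies outside φ (since dw Q xx').  Hence w ↦ d sends
-- the φ-neighbours of x in a component B of G_{E∖φ} injectively (again by the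
-- uniqueness of the square) to the φ-neighbours of x' in B.  By symmetry the
-- two numbers agree, and along walks in G_{E∖φ} they stay constant: the
-- components of G_{E∖φ} form an equitable partition of G_φ.
--
-- The theorem is the case φ = an R-class,
-- which is a union of Q-classes for the equivalence Q ⊆ R with the unique
-- square property.

module Submission where

open import Defs hiding (sym)
open import Data.Nat using (ℕ; suc; z≤n; s≤s; _≤_; _<_)
open import Data.Nat.Properties using (≤-antisym; ≤-trans; <-irrefl)
open import Data.Fin using (Fin) renaming (_<_ to _<ᶠ_)
import Data.Fin.Properties as FinP
open import Data.Fin.Subset using (Subset; ⁅_⁆; _∪_; ∣_∣)
  renaming (_∈_ to _∈ₛ_; _⊆_ to _⊆ₛ_; _⊂_ to _⊂ₛ_)
open import Data.Fin.Subset.Properties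
  using (_∈?_; _⊂?_; x∈⁅x⁆; p⊆p∪q; x∈p∪q⁺; x∈p∪q⁻; ∣⁅x⁆∣≡1; ∣p∣≤n; p⊂q⇒∣p∣<∣q∣)
  renaming (x∈⁅y⁆⇒x≡y to ∈⁅⁆⇒≡)
open import Data.Vec using (tabulate)
open import Data.Vec.Properties using (lookup∘tabulate; []=⇒lookup; lookup⇒[]=)
open import Data.Bool using (true)
import Data.Bool.Properties as BoolP
open import Data.Product using (Σ; _×_; _,_; ∃; proj₁; proj₂)
open import Data.Sum using (_⊎_; inj₁; inj₂)
open import Data.Empty using (⊥-elim)
open import Data.List using (List; []; _∷_; length; filter; allFin)
open import Data.List.Membership.Propositional using (_∈_)
open import Data.List.Membership.Propositional.Properties using (∈-filter⁺; ∈-filter⁻; ∈-allFin)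
open import Data.List.Relation.Unary.Any using (here; there)
open import Data.List.Relation.Unary.All using (lookup)
open import Data.List.Relation.Unary.AllPairs using (_∷_)
open import Data.List.Relation.Unary.Unique.Propositional using (Unique)
import Data.List.Relation.Unary.Unique.Propositional.Properties as UniqueP
open import Relation.Binary.PropositionalEquality
  using (_≡_; refl; sym; trans; cong; cong₂; subst; subst₂)
open import Relation.Binary.Definitions using (tri<; tri≈; tri>)
open import Relation.Nullary using (¬_; Dec; yes; no; does; ¬?)
open import Relation.Nullary.Decidable using (_×-dec_; dec-true)
open import Relation.Unary using (Decidable)
open import Function.Base using (_∘_)
open import Function.Bundles using (mk⇔; Equivalence)
open import Axiom.UniquenessOfIdentityProofs using (module Decidable⇒UIP)

private
  remove : ∀ {A : Set} {a : A} (ys : List A) → a ∈ ys → List A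
  remove (y ∷ ys) (here _)  = ys
  remove (y ∷ ys) (there p) = y ∷ remove ys p

  length-remove : ∀ {A : Set} {a : A} (ys : List A) (p : a ∈ ys) →
    length ys ≡ suc (length (remove ys p))
  length-remove (y ∷ ys) (here _)  = refl
  length-remove (y ∷ ys) (there p) = cong suc (length-remove ys p)

  ∈-remove : ∀ {A : Set} {a b : A} (ys : List A) (p : a ∈ ys) →
    b ∈ ys → ¬ b ≡ a → b ∈ remove ys p
  ∈-remove (y ∷ ys) (here refl) (here refl) b≢a = ⊥-elim (b≢a refl)
  ∈-remove (y ∷ ys) (here _)    (there q)   b≢a = q
  ∈-remove (y ∷ ys) (there p)   (here refl) b≢a = here refl
  ∈-remove (y ∷ ys) (there p)   (there q)   b≢a = there (∈-remove ys p q b≢a)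

-- A duplicate-free list maps injectively into ys only if it is not longer.
-- The map may depend on the membership proof, as the square map below does.
injection⇒length≤ : ∀ {A B : Set} (xs : List A) (ys : List B) → Unique xs →
  (f : ∀ {w} → w ∈ xs → B) → (∀ {w} (p : w ∈ xs) → f p ∈ ys) →
  (∀ {w w'} (p : w ∈ xs) (p' : w' ∈ xs) → f p ≡ f p' → w ≡ w') →
  length xs ≤ length ys
injection⇒length≤ []       ys _          f f∈ f-inj = z≤n
injection⇒length≤ (x ∷ xs) ys (x∉ ∷ uxs) f f∈ f-inj =
  subst (suc (length xs) ≤_) (sym (length-remove ys fx∈))
    (s≤s (injection⇒length≤ xs (remove ys fx∈) uxs (λ p → f (there p))
      (λ p → ∈-remove ys fx∈ (f∈ (there p))
               (λ eq → lookup x∉ p (sym (f-inj (there p) (here refl) eq))))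
      (λ p p' → f-inj (there p) (there p'))))
  where
  fx∈ : f (here refl) ∈ ys
  fx∈ = f∈ (here refl)

size-≤ : ∀ {n} {P P' : Fin n → Set} {k k'} → HasSize P k → HasSize P' k' →
  (F : ∀ {w} → P w → Fin n) → (∀ {w} (p : P w) → P' (F p)) →
  (∀ {w w'} (p : P w) (p' : P w') → F p ≡ F p' → w ≡ w') → k ≤ k'
size-≤ (xs , uxs , refl , ∈xs) (ys , _ , refl , ∈ys) F F∈ F-inj =
  injection⇒length≤ xs ys uxs (λ p → F (to (∈xs _) p))
    (λ p → from (∈ys _) (F∈ (to (∈xs _) p)))
    (λ p p' → F-inj (to (∈xs _) p) (to (∈xs _) p'))
  where open Equivalence

size-dec : ∀ {n} {P : Fin n → Set} → Decidable P → ∃ (HasSize P)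
size-dec {n} P? = length xs , xs , UniqueP.filter⁺ P? (UniqueP.allFin⁺ n) , refl ,
  λ y → mk⇔ (λ y∈ → proj₂ (∈-filter⁻ P? {xs = allFin n} y∈)) (∈-filter⁺ P? (∈-allFin y))
  where
  xs : List (Fin n)
  xs = filter P? (allFin n)

module Basics {n} (G : Graph n) where

  EdgeOn-sym : ∀ {e : Edge G} {x y} → EdgeOn e x y → EdgeOn e y x
  EdgeOn-sym (inj₁ p) = inj₂ p
  EdgeOn-sym (inj₂ p) = inj₁ p

  EdgeOn⇒Adj : ∀ {e : Edge G} {x y} → EdgeOn e x y → Adj G x y
  EdgeOn⇒Adj {e} (inj₁ (refl , refl)) = isAdj e
  EdgeOn⇒Adj {e} (inj₂ (refl , refl)) = trans (Graph.sym G _ _) (isAdj e)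

  -- An edge is determined by its endpoints (its proof fields are irrelevant).
  edge-≡ : ∀ (e e' : Edge G) → src e ≡ src e' → tgt e ≡ tgt e' → e ≡ e'
  edge-≡ (edge s t s<t a) (edge .s .t s<t' a') refl refl =
    cong₂ (edge s t) (FinP.<-irrelevant s<t s<t') (Decidable⇒UIP.≡-irrelevant BoolP._≟_ a a')

  edge-unique : ∀ {e e' : Edge G} {x y} → EdgeOn e x y → EdgeOn e' x y → e ≡ e'
  edge-unique {e} {e'} (inj₁ (s , t)) (inj₁ (s' , t')) = edge-≡ e e' (trans s (sym s')) (trans t (sym t'))
  edge-unique {e} {e'} (inj₂ (s , t)) (inj₂ (s' , t')) = edge-≡ e e' (trans s (sym s')) (trans t (sym t'))
  edge-unique {e} {e'} (inj₁ (refl , refl)) (inj₂ (s' , t')) =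
    ⊥-elim (FinP.<-asym (src<tgt e) (subst₂ _<ᶠ_ s' t' (src<tgt e')))
  edge-unique {e} {e'} (inj₂ (refl , refl)) (inj₁ (s' , t')) =
    ⊥-elim (FinP.<-asym (src<tgt e) (subst₂ _<ᶠ_ s' t' (src<tgt e')))

  no-loop : ∀ x → ¬ Adj G x x
  no-loop x a with () ← trans (sym a) (irrefl G x)

  ChordlessSquare-reverse : ∀ {a b c d} → ChordlessSquare G a b c d → ChordlessSquare G d c b a
  ChordlessSquare-reverse (a≢b , a≢c , a≢d , b≢c , b≢d , c≢d , ab , bc , cd , da , ¬ac , ¬bd) =
    (c≢d ∘ sym) , (b≢d ∘ sym) , (a≢d ∘ sym) , (b≢c ∘ sym) , (a≢c ∘ sym) , (a≢b ∘ sym) ,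
    flip cd , flip bc , flip ab , flip da , ¬bd ∘ flip , ¬ac ∘ flip
    where
    flip : ∀ {u v} → Adj G u v → Adj G v u
    flip = trans (Graph.sym G _ _)

  edgeOn : ∀ x y → Adj G x y → Σ (Edge G) λ e → EdgeOn e x y
  edgeOn x y a with FinP.<-cmp x y
  ... | tri< x<y _ _ = edge x y x<y a , inj₁ (refl , refl)
  ... | tri≈ _ refl _ = ⊥-elim (no-loop x a)
  ... | tri> _ _ y<x = edge y x y<x (trans (Graph.sym G y x) a) , inj₂ (refl , refl)

  AdjIn-dec : ∀ {φ : EdgeSet G} → Decidable φ → ∀ x y → Dec (AdjIn φ x y)
  AdjIn-dec {φ} φ? x y with adj G x y BoolP.≟ true
  ... | no ¬a = no λ (e , on , _) → ¬a (EdgeOn⇒Adj {e} on)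
  ... | yes a with edgeOn x y a
  ... | e , on with φ? e
  ... | yes φe = yes (e , on , φe)
  ... | no ¬φe = no λ (e' , on' , φe') → ¬φe (subst φ (edge-unique {e'} {e} on' on) φe')

-- Starting from {z}, repeatedly add all G_φ-neighbours.  The i-th layer is
-- either closed under G_φ-adjacency or has more than i elements, so the
-- n-th layer is closed and is exactly the component of z.

module Reachability {n} {G : Graph n} (φ : EdgeSet G)
                    (adj? : ∀ x y → Dec (AdjIn φ x y)) (z : Fin n) where

  subsetOf : {P : Fin n → Set} → Decidable P → Subset n
  subsetOf P? = tabulate (λ w → does (P? w))

  ∈-subsetOf⁺ : ∀ {P : Fin n → Set} (P? : Decidable P) {w} → P w → w ∈ₛ subsetOf P?
  ∈-subsetOf⁺ P? {w} p = lookup⇒[]= w _ (trans (lookup∘tabulate _ w) (dec-true (P? w) p))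

  ∈-subsetOf⁻ : ∀ {P : Fin n → Set} (P? : Decidable P) {w} → w ∈ₛ subsetOf P? → P w
  ∈-subsetOf⁻ P? {w} w∈ with P? w | trans (sym (lookup∘tabulate _ w)) ([]=⇒lookup w∈)
  ... | yes p | _ = p

  Frontier : Subset n → Fin n → Set
  Frontier S w = ∃ λ y → y ∈ₛ S × AdjIn φ y w

  frontier? : ∀ S → Decidable (Frontier S)
  frontier? S w = FinP.any? (λ y → (y ∈? S) ×-dec adj? y w)

  grow : Subset n → Subset n
  grow S = S ∪ subsetOf (frontier? S)

  grow-⊇ : ∀ S → S ⊆ₛ grow S
  grow-⊇ S = p⊆p∪q _

  grow-step : ∀ S {y w} → y ∈ₛ S → AdjIn φ y w → w ∈ₛ grow S
  grow-step S y∈ a = x∈p∪q⁺ (inj₂ (∈-subsetOf⁺ (frontier? S) (_ , y∈ , a)))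

  grow-⁻ : ∀ S {w} → w ∈ₛ grow S → w ∈ₛ S ⊎ Frontier S w
  grow-⁻ S w∈ with x∈p∪q⁻ S _ w∈
  ... | inj₁ w∈S = inj₁ w∈S
  ... | inj₂ w∈F = inj₂ (∈-subsetOf⁻ (frontier? S) w∈F)

  Closed : Subset n → Set
  Closed S = ∀ {y w} → y ∈ₛ S → AdjIn φ y w → w ∈ₛ S

  closed⇒grow-⊆ : ∀ S → Closed S → grow S ⊆ₛ S
  closed⇒grow-⊆ S closed w∈ with grow-⁻ S w∈
  ... | inj₁ w∈S = w∈S
  ... | inj₂ (y , y∈ , a) = closed y∈ a

  closed⇒grow-closed : ∀ S → Closed S → Closed (grow S)
  closed⇒grow-closed S closed y∈ a = grow-⊇ S (closed (closed⇒grow-⊆ S closed y∈) a)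

  grow-closed-or-⊃ : ∀ S → Closed (grow S) ⊎ S ⊂ₛ grow S
  grow-closed-or-⊃ S with S ⊂? grow S
  ... | yes S⊂ = inj₂ S⊂
  ... | no ¬S⊂ = inj₁ λ y∈ a → grow-⊇ S (S-closed (grow-⊆ y∈) a)
    where
    grow-⊆ : grow S ⊆ₛ S
    grow-⊆ {w} w∈ with w ∈? S
    ... | yes w∈S = w∈S
    ... | no w∉S = ⊥-elim (¬S⊂ (grow-⊇ S , w , w∈ , w∉S))
    S-closed : Closed S
    S-closed y∈ a = grow-⊆ (grow-step S y∈ a)

  layer : ℕ → Subset n
  layer 0       = ⁅ z ⁆
  layer (suc i) = grow (layer i)

  z∈layer : ∀ i → z ∈ₛ layer i
  z∈layer 0       = x∈⁅x⁆ z
  z∈layer (suc i) = grow-⊇ _ (z∈layer i)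

  layer-sound : ∀ i {w} → w ∈ₛ layer i → Reach φ z w
  layer-sound 0 w∈ with ∈⁅⁆⇒≡ z w∈
  ... | refl = here
  layer-sound (suc i) w∈ with grow-⁻ (layer i) w∈
  ... | inj₁ w∈i = layer-sound i w∈i
  ... | inj₂ (y , y∈ , a) = step (layer-sound i y∈) a

  layer-closed-or-large : ∀ i → Closed (layer i) ⊎ i < ∣ layer i ∣
  layer-closed-or-large 0 = inj₂ (subst (0 <_) (sym (∣⁅x⁆∣≡1 z)) (s≤s z≤n))
  layer-closed-or-large (suc i) with layer-closed-or-large i
  ... | inj₁ closed = inj₁ (closed⇒grow-closed _ closed)
  ... | inj₂ large with grow-closed-or-⊃ (layer i)
  ... | inj₁ closed = inj₁ closed
  ... | inj₂ grows  = inj₂ (≤-trans (s≤s large) (p⊂q⇒∣p∣<∣q∣ grows))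

  -- a subset of Fin n has at most n elements, so layer n is closed
  layer-n-closed : Closed (layer n)
  layer-n-closed with layer-closed-or-large n
  ... | inj₁ closed = closed
  ... | inj₂ large  = ⊥-elim (<-irrefl refl (≤-trans large (∣p∣≤n (layer n))))

  layer-complete : ∀ {w} → Reach φ z w → w ∈ₛ layer n
  layer-complete here       = z∈layer n
  layer-complete (step r a) = layer-n-closed (layer-complete r) a

  Reach-dec : Decidable (Reach φ z)
  Reach-dec w with w ∈? layer n
  ... | yes w∈ = yes (layer-sound n w∈)
  ... | no w∉  = no λ r → w∉ (layer-complete r)

module Squares {n} {G : Graph n} (Q : EdgeRel G) (Q-equiv : IsEquivRel Q)
               (usp : UniqueSquareProperty Q)
               (φ : EdgeSet G) (φ-closed : ∀ e g → Rel⟨ Q ⟩ e g → φ e → φ g) where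

  open Basics G
  private module Q = IsEquivRel Q-equiv

  ψ : EdgeSet G
  ψ f = ¬ φ f

  ψ-closed : ∀ f h → Rel⟨ Q ⟩ f h → ψ f → ψ h
  ψ-closed f h fQh ψf φh = ψf (φ-closed h f (Q.sym f h fQh) φh)

  φ-ψ-apart : ∀ {e f} → φ e → ψ f → ¬ Rel⟨ Q ⟩ e f
  φ-ψ-apart φe ψf eQf = ψf (φ-closed _ _ eQf φe)

  SquareOn : Edge G → Fin n → Fin n → Fin n → Fin n → Set
  SquareOn f x x' w d = Σ (Edge G) λ e → EdgeOn e x w × φ e ×
    ChordlessSquare G w x x' d × RelToEdgeOn Q e x' d × RelToEdgeOn Q f d w

  module _ {f : Edge G} {x x'} (f-on : EdgeOn f x x') (ψf : ψ f) where

    square : ∀ {w} → AdjIn φ x w → ∃ (SquareOn f x x' w)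
    square {w} (e , e-on , φe)
      with usp e f w x x' (EdgeOn-sym {e} e-on) f-on w≢x' (φ-ψ-apart φe ψf)
      where
      w≢x' : ¬ w ≡ x'
      w≢x' refl = ψf (subst φ (edge-unique {e} {f} e-on f-on) φe)
    ... | d , d-square , _ = d , e , e-on , φe , d-square

    -- d is a φ-neighbour of x', since x'd Q xw
    opposite-φ : ∀ {w d} → SquareOn f x x' w d → AdjIn φ x' d
    opposite-φ (e , _ , φe , _ , (g , g-on , eQg) , _) = g , g-on , φ-closed e g eQg φe

    -- dw lies outside φ, since dw Q xx'
    closing-ψ : ∀ {w d} → SquareOn f x x' w d → AdjIn ψ w d
    closing-ψ (_ , _ , _ , _ , _ , (h , h-on , fQh)) =
      h , EdgeOn-sym {h} h-on , ψ-closed f h fQh ψf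

    -- the same square, seen as the square d-x'-x-w through the edges x'd and x'x
    reverse : ∀ {g w d} → EdgeOn g x' d → SquareOn f x x' w d →
      ChordlessSquare G d x' x w × RelToEdgeOn Q g x w × RelToEdgeOn Q f w d
    reverse {g} g-on (e , e-on , _ , sq , (g' , g'-on , eQg') , (h , h-on , fQh)) =
      ChordlessSquare-reverse sq ,
      (e , e-on , Q.sym e g (subst (Rel⟨ Q ⟩ e) (edge-unique {g'} {g} g'-on g-on) eQg')) ,
      (h , EdgeOn-sym {h} h-on , fQh)

    -- w is recovered from d: by the unique square property for x'd and x'x
    square-injective : ∀ {w w' d} → SquareOn f x x' w d → SquareOn f x x' w' d → w ≡ w'
    square-injective {d = d} s@(_ , _ , _ , (_ , _ , _ , _ , x≢d , _) , _) s' with opposite-φ s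
    ... | g , g-on , φg
      with usp g f d x' x (EdgeOn-sym {g} g-on) (EdgeOn-sym {f} f-on) (x≢d ∘ sym) (φ-ψ-apart φg ψf)
    ... | _ , _ , unique = trans (sym (unique (reverse g-on s))) (unique (reverse g-on s'))

  Neighbours : Fin n → Fin n → Fin n → Set
  Neighbours z x y = AdjIn φ x y × Reach ψ z y

  -- w ↦ d injects the neighbours of x in a component into those of x'
  neighbours-≤ : ∀ {f x x' z k k'} → EdgeOn f x x' → ψ f →
    HasSize (Neighbours z x) k → HasSize (Neighbours z x') k' → k ≤ k'
  neighbours-≤ f-on ψf sx sx' =
    size-≤ sx sx' (λ (a , _) → proj₁ (square f-on ψf a))
      (λ (a , r) → let s = proj₂ (square f-on ψf a) in
        opposite-φ f-on ψf s , step r (closing-ψ f-on ψf s))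
      (λ (a , _) (a' , _) d≡d' →
        square-injective f-on ψf (proj₂ (square f-on ψf a))
          (subst (SquareOn _ _ _ _) (sym d≡d') (proj₂ (square f-on ψf a'))))

  neighbours-≡ : ∀ {x x' z k k'} → AdjIn ψ x x' →
    HasSize (Neighbours z x) k → HasSize (Neighbours z x') k' → k ≡ k'
  neighbours-≡ (f , f-on , ψf) sx sx' =
    ≤-antisym (neighbours-≤ f-on ψf sx sx') (neighbours-≤ (EdgeOn-sym {f} f-on) ψf sx' sx)

  neighbours-size : Decidable φ → ∀ z x → ∃ (HasSize (Neighbours z x))
  neighbours-size φ? z x = size-dec λ y →
    AdjIn-dec φ? x y ×-dec Reachability.Reach-dec ψ (AdjIn-dec (¬? ∘ φ?)) z y

  equitable : Decidable φ → IsEquitable (Reach ψ) (AdjIn φ)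
  equitable φ? x x' z x↝x' with neighbours-size φ? z x
  ... | k , sx = k , sx , along x↝x'
    where
    along : ∀ {y} → Reach ψ x y → HasSize (Neighbours z y) k
    along here = sx
    along (step {z = w} x↝y y-w) with neighbours-size φ? z w
    ... | k' , sw = subst (HasSize (Neighbours z w)) (sym (neighbours-≡ y-w (along x↝y) sw)) sw

-- An R-class is a union of Q-classes for any Q ⊆ R, so the square argument
-- applies to the equivalence Q witnessing that R is a USP-relation.
mainTheorem9 : ∀ {n} (G : Graph n) → Connected G →
    (R : EdgeRel G) → IsEquivRel R → IsUSPRelation R →
    (e₀ : Edge G) →
    IsEquitable (Reach (λ f → ¬ Rel⟨ R ⟩ e₀ f)) (AdjIn (λ f → Rel⟨ R ⟩ e₀ f))
mainTheorem9 G _ R R-equiv (Q , Q-equiv , usp , Q⊆R) e₀ =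
  Squares.equitable Q Q-equiv usp R-class R-class-closed (λ f → R e₀ f BoolP.≟ true)
  where
  R-class : EdgeSet G
  R-class f = Rel⟨ R ⟩ e₀ f
  R-class-closed : ∀ e g → Rel⟨ Q ⟩ e g → R-class e → R-class g
  R-class-closed e g eQg e₀Re = IsEquivRel.trans R-equiv e₀ e g e₀Re (Q⊆R e g eQg)
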